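{- Let $k$ be a positive integer and let $D$ be a digraph with $D\in\mathcal{L}$ and $\ell_s(D)>0$. Then either $\ell_s(D)\ge k$ or the underlying undirected graph $UN(D)$ of $D$ has pathwidth at most $k^3$.
   Context: Digraphs are finite, without loops or parallel arcs. An out-tree of a digraph $D$ is a subdigraph $T$ that is an oriented tree with exactly one vertex of in-degree zero (the root); its leaves are its vertices of out-degree zero. An out-branching of $D$ is an out-tree $T$ with $V(T)=V(D)$. $\ell(D)$ denotes the maximum number of leaves of an out-tree of $D$, and $\ell_s(D)$ the maximum number of leaves of an out-branching of $D$, with $\ell_s(D)=0$ if $D$ has no out-branching. $\mathcal{L}$ is the family of digraphs $D$ for which either $\ell_s(D)=0$ or $\ell_s(D)=\ell(D)$. The underlying undirected graph $UN(D)$ is obtained from $D$ by forgetting arc orientations and replacing each resulting pair of parallel edges by a single edge. A path decomposition of a graph $G$ is a sequence $(X_1,\dots,X_r)$ of subsets of $V(G)$ whose union is $V(G)$, such that every edge has both endpoints in some $X_i$, and for every vertex $v$ the indices $i$ with $v\in X_i$ form an interval; its width is $\max_i |X_i|-1$, and the pathwidth of $G$ is the minimum width of a path decomposition of $G$. -}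

module Defs where

open import Data.Nat using (ℕ; zero; suc; _+_; _∸_; _≤_; _≡ᵇ_)
open import Data.Bool using (Bool; true; false; _∧_; _∨_)
open import Data.Fin using (Fin)
open import Data.List using (List; map; allFin)
open import Data.Nat.ListAction using (sum)
open import Data.Product using (Σ; _×_; ∃; ∃-syntax; _,_)
open import Data.Sum using (_⊎_)
open import Relation.Nullary using (¬_)
open import Relation.Binary.PropositionalEquality using (_≡_)

-- Finite digraph on vertex set Fin n: arc u v = true iff (u,v) is an arc.
-- A relation cannot have parallel arcs; loops are excluded explicitly.
record Digraph (n : ℕ) : Set where
  field
    arc      : Fin n → Fin n → Bool
    loopless : ∀ v → arc v v ≡ false
open Digraph public

boolToℕ : Bool → ℕ
boolToℕ true  = 1
boolToℕ false = 0

count : ∀ {n} → (Fin n → Bool) → ℕ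
count {n} p = sum (map (λ i → boolToℕ (p i)) (allFin n))

data Reach {n : ℕ} (E : Fin n → Fin n → Bool) : Fin n → Fin n → Set where
  here : ∀ {u} → Reach E u u
  step : ∀ {u v w} → E u v ≡ true → Reach E v w → Reach E u w

record SubDigraph {n : ℕ} (D : Digraph n) : Set where
  field
    V   : Fin n → Bool
    A   : Fin n → Fin n → Bool
    A⊆  : ∀ u v → A u v ≡ true → (arc D u v ≡ true) × (V u ≡ true) × (V v ≡ true)
open SubDigraph public

module _ {n : ℕ} {D : Digraph n} (T : SubDigraph D) where
  inDeg : Fin n → ℕ
  inDeg v = count (λ u → A T u v)

  outDeg : Fin n → ℕ
  outDeg u = count (λ v → A T u v)

  numArcs : ℕ
  numArcs = sum (map outDeg (allFin n))

  numVertices : ℕ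
  numVertices = count (V T)

  UNedge : Fin n → Fin n → Bool
  UNedge u v = A T u v ∨ A T v u

  -- T is an oriented tree: no 2-cycles (so UN(T) has exactly numArcs edges),
  -- UN(T) is connected on V(T), and |E(UN T)| = |V(T)| - 1 (with V(T) nonempty).
  IsOrientedTree : Set
  IsOrientedTree =
      (∀ u v → A T u v ≡ true → A T v u ≡ false)
    × (Σ (Fin n) λ v → V T v ≡ true)
    × (∀ u v → V T u ≡ true → V T v ≡ true → Reach UNedge u v)
    × (numArcs + 1 ≡ numVertices)

  IsOutTree : Set
  IsOutTree = IsOrientedTree
    × (∃[ r ] (V T r ≡ true × inDeg r ≡ 0
               × (∀ v → V T v ≡ true → inDeg v ≡ 0 → v ≡ r)))

  IsOutBranching : Set
  IsOutBranching = IsOutTree × (∀ v → V T v ≡ true)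

  leaves : ℕ
  leaves = count (λ v → V T v ∧ (outDeg v ≡ᵇ 0))

IsEll : ∀ {n} → Digraph n → ℕ → Set
IsEll D m = (∃[ T ] (IsOutTree {D = D} T × leaves T ≡ m))
          × (∀ T → IsOutTree {D = D} T → leaves T ≤ m)

HasOutBranching : ∀ {n} → Digraph n → Set
HasOutBranching D = ∃[ T ] IsOutBranching {D = D} T

IsEllS : ∀ {n} → Digraph n → ℕ → Set
IsEllS D m =
    ((¬ HasOutBranching D) × m ≡ 0)
  ⊎ ((∃[ T ] (IsOutBranching {D = D} T × leaves T ≡ m))
     × (∀ T → IsOutBranching {D = D} T → leaves T ≤ m))

InL : ∀ {n} → Digraph n → Set
InL D = ∀ m → IsEllS D m → (m ≡ 0) ⊎ IsEll D m

UN : ∀ {n} → Digraph n → Fin n → Fin n → Bool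
UN D u v = arc D u v ∨ arc D v u

record PathDecomposition {n : ℕ} (E : Fin n → Fin n → Bool) : Set where
  field
    r       : ℕ
    X       : Fin r → Fin n → Bool
    covers  : ∀ v → ∃[ i ] X i v ≡ true
    edges   : ∀ u v → E u v ≡ true → ∃[ i ] (X i u ≡ true × X i v ≡ true)
    interval : ∀ v (i j l : Fin r) → i Data.Fin.≤ j → j Data.Fin.≤ l →
               X i v ≡ true → X l v ≡ true → X j v ≡ true
open PathDecomposition public

WidthAtMost : ∀ {n} {E : Fin n → Fin n → Bool} → PathDecomposition E → ℕ → Set
WidthAtMost P w = ∀ i → count (X P i) ≤ suc w

PathwidthAtMost : ∀ {n} → (Fin n → Fin n → Bool) → ℕ → Set
PathwidthAtMost E w = ∃[ P ] WidthAtMost {E = E} P w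

{-# OPTIONS --safe #-}
module Submission where

-- Fix an out-branching of D and let depth be the distance from its root; every out-tree of D has
-- at most m = ℓ(D) = ℓ_s(D) leaves. If U is a subtree of the branching rooted at x, giving each
-- out-neighbour of U outside U an in-neighbour in U as its parent yields an out-tree in which all
-- these out-neighbours are leaves, so U has at most m of them.
--
-- Bag t holds the vertices of depth t and the out-neighbours ∂⁺ of the ball {depth ≤ t} and of its
-- complement. An arc u → v lies in bag (depth u) if depth u ≤ depth v, and otherwise in bag
-- (depth u − 1), which contains u as an out-neighbour of the ball (through its parent) and v as an
-- out-neighbour of the complement (through u); every vertex lies in an interval of bags around its
-- depth. Level t + 1 and the first boundary have at most m vertices (take U to be the ball), and
-- each vertex of the second boundary is an out-neighbour of the subtree below some vertex of depth
-- t + 1, so that boundary has at most m · m vertices. Hence every bag has at most m (m + 2) ≤ k³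
-- vertices once m < k.

open import Defs
open import Data.Nat.Properties hiding (_≟_)
open import Algebra.Properties.Semiring.Sum +-*-semiring
  using (sum-syntax; sum-cong-≗; sum-replicate-zero; ∑-comm; ∑-distrib-+; *-distribʳ-sum)
open import Data.Bool using (Bool; true; false; not; _∧_; _∨_; if_then_else_)
import Data.Bool.Properties as Bool
open import Data.Empty using (⊥)
open import Data.Fin using (Fin; zero; suc; toℕ; fromℕ<)
open import Data.Fin.Properties using (_≟_; any?; toℕ-fromℕ<)
open import Data.List using (map; allFin; tabulate)
open import Data.List.Properties using (map-tabulate)
import Data.Nat as ℕ
open import Data.Nat using (ℕ; zero; suc; _+_; _*_; _∸_; _^_; _≤_; _<_; _≤?_; _<?_; _≡ᵇ_; z≤n; s≤s; s≤s⁻¹)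
open import Data.Nat.GeneralisedArithmetic using (iterate)
import Data.Nat.ListAction as List
open import Data.Nat.Tactic.RingSolver using (solve-∀)
open import Data.Product using (_×_; _,_; ∃-syntax; proj₁; proj₂)
open import Data.Sum using (_⊎_; inj₁; inj₂)
open import Function using (_∘_; id)
open import Relation.Binary.Definitions using (tri<; tri≈; tri>)
open import Relation.Binary.PropositionalEquality
open import Relation.Nullary using (Dec; yes; no; does; ¬_; _×-dec_; _⊎-dec_; contradiction)
open import Relation.Nullary.Decidable using (dec-true; dec-false)

-- Finite sums and counting

does⇒ : ∀ {a} {A : Set a} (a? : Dec A) → does a? ≡ true → A
does⇒ (yes a) _ = a

does⇒¬ : ∀ {a} {A : Set a} (a? : Dec A) → does a? ≡ false → ¬ A
does⇒¬ (no ¬a) _ = ¬a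

∨-split : ∀ {x y} → x ∨ y ≡ true → x ≡ true ⊎ y ≡ true
∨-split {true}  _ = inj₁ refl
∨-split {false} e = inj₂ e

sum-map-allFin : ∀ {n} (f : Fin n → ℕ) → List.sum (map f (allFin n)) ≡ ∑[ i < n ] f i
sum-map-allFin f = trans (cong List.sum (map-tabulate id f)) (sum-tabulate f)
  where
  sum-tabulate : ∀ {n} (f : Fin n → ℕ) → List.sum (tabulate f) ≡ ∑[ i < n ] f i
  sum-tabulate {zero}  f = refl
  sum-tabulate {suc n} f = cong (f zero +_) (sum-tabulate (f ∘ suc))

∑-mono-≤ : ∀ {n} {f g : Fin n → ℕ} → (∀ i → f i ≤ g i) → ∑[ i < n ] f i ≤ ∑[ i < n ] g i
∑-mono-≤ {zero}  f≤g = z≤n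
∑-mono-≤ {suc n} f≤g = +-mono-≤ (f≤g zero) (∑-mono-≤ (f≤g ∘ suc))

term≤∑ : ∀ {n} (f : Fin n → ℕ) i → f i ≤ ∑[ j < n ] f j
term≤∑ f zero    = m≤m+n (f zero) _
term≤∑ f (suc i) = ≤-trans (term≤∑ (f ∘ suc) i) (m≤n+m _ (f zero))

∑-tight : ∀ {n} {f g : Fin n → ℕ} → (∀ i → f i ≤ g i) → ∑[ i < n ] g i ≤ ∑[ i < n ] f i →
          ∀ i → f i ≡ g i
∑-tight {suc n} {f} {g} f≤g ∑g≤∑f zero = ≤-antisym (f≤g zero)
  (+-cancelʳ-≤ _ _ _ (≤-trans (+-monoʳ-≤ (g zero) (∑-mono-≤ (f≤g ∘ suc))) ∑g≤∑f))
∑-tight {suc n} {f} {g} f≤g ∑g≤∑f (suc i) = ∑-tight (f≤g ∘ suc)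
  (+-cancelˡ-≤ (f zero) _ _ (≤-trans (+-monoˡ-≤ _ (f≤g zero)) ∑g≤∑f)) i

infixl 6 _─_
_─_ : ∀ {n} → (Fin n → Bool) → Fin n → Fin n → Bool
(P ─ x) i = not (does (i ≟ x)) ∧ P i

─-intro : ∀ {n} {P : Fin n → Bool} {x i : Fin n} → P i ≡ true → i ≢ x → (P ─ x) i ≡ true
─-intro {x = x} {i} Pi i≢x with i ≟ x
... | yes i≡x = contradiction i≡x i≢x
... | no  _   = Pi

∑-─ : ∀ {n} (P : Fin n → Bool) x → P x ≡ true →
      suc (∑[ i < n ] boolToℕ ((P ─ x) i)) ≡ ∑[ i < n ] boolToℕ (P i)
∑-─ P zero    Px rewrite Px = refl
∑-─ P (suc x) Px = trans (sym (+-suc (boolToℕ (P zero)) _)) (cong (boolToℕ (P zero) +_) (∑-─ (P ∘ suc) x Px))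

count≡∑ : ∀ {n} (P : Fin n → Bool) → count P ≡ ∑[ i < n ] boolToℕ (P i)
count≡∑ P = sum-map-allFin (boolToℕ ∘ P)

module _ {n : ℕ} where

  count-mono : {P Q : Fin n → Bool} → (∀ i → P i ≡ true → Q i ≡ true) → count P ≤ count Q
  count-mono {P} {Q} P⊆Q = begin
    count P                    ≡⟨ count≡∑ P ⟩
    ∑[ i < n ] boolToℕ (P i)   ≤⟨ ∑-mono-≤ (λ i → pointwise (P i) (Q i) (P⊆Q i)) ⟩
    ∑[ i < n ] boolToℕ (Q i)   ≡⟨ count≡∑ Q ⟨
    count Q                    ∎
    where
    open ≤-Reasoning
    pointwise : ∀ x y → (x ≡ true → y ≡ true) → boolToℕ x ≤ boolToℕ y
    pointwise false y _   = z≤n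
    pointwise true  y x⇒y rewrite x⇒y refl = ≤-refl

  count-∨ : (P Q : Fin n → Bool) → count (λ i → P i ∨ Q i) ≤ count P + count Q
  count-∨ P Q = begin
    count (λ i → P i ∨ Q i)                           ≡⟨ count≡∑ (λ i → P i ∨ Q i) ⟩
    ∑[ i < n ] boolToℕ (P i ∨ Q i)                    ≤⟨ ∑-mono-≤ (λ i → pointwise (P i) (Q i)) ⟩
    ∑[ i < n ] (boolToℕ (P i) + boolToℕ (Q i))        ≡⟨ ∑-distrib-+ (boolToℕ ∘ P) (boolToℕ ∘ Q) ⟩
    ∑[ i < n ] boolToℕ (P i) + ∑[ i < n ] boolToℕ (Q i) ≡⟨ cong₂ _+_ (count≡∑ P) (count≡∑ Q) ⟨
    count P + count Q                                 ∎
    where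
    open ≤-Reasoning
    pointwise : ∀ x y → boolToℕ (x ∨ y) ≤ boolToℕ x + boolToℕ y
    pointwise true  y = s≤s z≤n
    pointwise false y = ≤-refl

  1≤count : (P : Fin n → Bool) {i : Fin n} → P i ≡ true → 1 ≤ count P
  1≤count P {i} Pi = begin
    1                          ≡⟨ cong boolToℕ Pi ⟨
    boolToℕ (P i)              ≤⟨ term≤∑ (boolToℕ ∘ P) i ⟩
    ∑[ j < n ] boolToℕ (P j)   ≡⟨ count≡∑ P ⟨
    count P                    ∎
    where
    open ≤-Reasoning

  count≡0⇒false : (P : Fin n → Bool) → count P ≡ 0 → ∀ i → P i ≡ false
  count≡0⇒false P P≡0 i = Bool.¬-not λ Pi → 1+n≰n (≤-trans (1≤count P Pi) (≤-reflexive P≡0))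

  all-false⇒count≡0 : {P : Fin n → Bool} → (∀ i → P i ≡ false) → count P ≡ 0
  all-false⇒count≡0 {P} none =
    trans (count≡∑ P) (trans (sum-cong-≗ (cong boolToℕ ∘ none)) (sum-replicate-zero n))

  count≢0⇒∃ : (P : Fin n → Bool) → count P ≢ 0 → ∃[ i ] P i ≡ true
  count≢0⇒∃ P P≢0 with any? (λ i → P i Bool.≟ true)
  ... | yes witness = witness
  ... | no  none    = contradiction (all-false⇒count≡0 (λ i → Bool.¬-not (λ Pi → none (i , Pi)))) P≢0

  count-─ : (P : Fin n → Bool) {x : Fin n} → P x ≡ true → suc (count (P ─ x)) ≡ count P
  count-─ P {x} Px = begin
    suc (count (P ─ x))                     ≡⟨ cong suc (count≡∑ (P ─ x)) ⟩
    suc (∑[ i < n ] boolToℕ ((P ─ x) i))    ≡⟨ ∑-─ P x Px ⟩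
    ∑[ i < n ] boolToℕ (P i)                ≡⟨ count≡∑ P ⟨
    count P                                 ∎
    where
    open ≡-Reasoning

  count-singleton : (x : Fin n) → count (λ i → does (i ≟ x)) ≡ 1
  count-singleton x = trans (sym (count-─ (λ i → does (i ≟ x)) (dec-true (x ≟ x) refl)))
                            (cong suc (all-false⇒count≡0 (λ i → Bool.∧-inverseˡ (does (i ≟ x)))))

  count≡1⇒unique : (P : Fin n → Bool) → count P ≡ 1 → ∀ {a b} → P a ≡ true → P b ≡ true → b ≡ a
  count≡1⇒unique P P≡1 {a} {b} Pa Pb
    with b ≟ a | count≡0⇒false (P ─ a) (suc-injective (trans (count-─ P Pa) P≡1)) b
  ... | yes b≡a | _         = b≡a
  ... | no  _   | Pb≡false = contradiction (trans (sym Pb) Pb≡false) λ ()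

  count-cover : ∀ {m} (X : Fin m → Bool) (N : Fin m → Fin n → Bool) (S : Fin n → Bool) {b : ℕ} →
                (∀ v → S v ≡ true → ∃[ x ] (X x ≡ true × N x v ≡ true)) →
                (∀ x → X x ≡ true → count (N x) ≤ b) →
                count S ≤ count X * b
  count-cover {m} X N S {b} covered small = begin
    count S                                                   ≡⟨ count≡∑ S ⟩
    ∑[ v < n ] boolToℕ (S v)                                  ≤⟨ ∑-mono-≤ covering ⟩
    ∑[ v < n ] ∑[ x < m ] boolToℕ (X x ∧ N x v)               ≡⟨ ∑-comm (λ v x → boolToℕ (X x ∧ N x v)) ⟩
    ∑[ x < m ] ∑[ v < n ] boolToℕ (X x ∧ N x v)               ≤⟨ ∑-mono-≤ bounded ⟩
    ∑[ x < m ] (boolToℕ (X x) * b)                            ≡⟨ *-distribʳ-sum b (boolToℕ ∘ X) ⟨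
    (∑[ x < m ] boolToℕ (X x)) * b                            ≡⟨ cong (_* b) (count≡∑ X) ⟨
    count X * b                                               ∎
    where
    open ≤-Reasoning
    covering : ∀ v → boolToℕ (S v) ≤ ∑[ x < m ] boolToℕ (X x ∧ N x v)
    covering v with S v in Sv
    ... | false = z≤n
    ... | true with covered v Sv
    ...   | x , Xx , Nxv =
      subst (_≤ _) (cong boolToℕ (cong₂ _∧_ Xx Nxv)) (term≤∑ (λ x → boolToℕ (X x ∧ N x v)) x)
    bounded : ∀ x → ∑[ v < n ] boolToℕ (X x ∧ N x v) ≤ boolToℕ (X x) * b
    bounded x with X x in Xx
    ... | false = ≤-reflexive (sum-replicate-zero n)
    ... | true  = begin
      ∑[ v < n ] boolToℕ (N x v)  ≡⟨ count≡∑ (N x) ⟨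
      count (N x)                 ≤⟨ small x Xx ⟩
      b                           ≡⟨ +-identityʳ b ⟨
      1 * b                       ∎

choose : ∀ {n} → (Fin n → Bool) → Fin n → Fin n
choose P default with any? (λ i → P i Bool.≟ true)
... | yes (i , _) = i
... | no  _       = default

choose-correct : ∀ {n} (P : Fin n → Bool) default {i} → P i ≡ true → P (choose P default) ≡ true
choose-correct P default {i} Pi with any? (λ i → P i Bool.≟ true)
... | yes (_ , Pj) = Pj
... | no  none     = contradiction (i , Pi) none

-- Parent trees

data Descendant {n} (parent : Fin n → Fin n) (x : Fin n) : Fin n → Set where
  self  : Descendant parent x x
  child : ∀ {v} → v ≢ x → Descendant parent x (parent v) → Descendant parent x v

module _ {n} {parent : Fin n → Fin n} {x : Fin n} where

  generation : ∀ {v} → Descendant parent x v → ℕ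
  generation self        = 0
  generation (child _ δ) = suc (generation δ)

  generation-unique : ∀ {u v} → u ≡ v → (δ : Descendant parent x u) (ε : Descendant parent x v) →
                      generation δ ≡ generation ε
  generation-unique refl self          self          = refl
  generation-unique refl self          (child x≢x _) = contradiction refl x≢x
  generation-unique refl (child v≢v _) self          = contradiction refl v≢v
  generation-unique refl (child _ δ)   (child _ ε)   = cong suc (generation-unique refl δ ε)

  generation-parent : ∀ {v} → v ≢ x → (δ : Descendant parent x v) (ε : Descendant parent x (parent v)) →
                      generation δ ≡ suc (generation ε)
  generation-parent v≢v self        ε = contradiction refl v≢v
  generation-parent _   (child _ δ) ε = cong suc (generation-unique refl δ ε)

module _ {n} {E : Fin n → Fin n → Bool} where

  Reach-trans : ∀ {u v w} → Reach E u v → Reach E v w → Reach E u w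
  Reach-trans here         q = q
  Reach-trans (step e p) q = step e (Reach-trans p q)

  Reach-reverse : (∀ u v → E u v ≡ true → E v u ≡ true) → ∀ {u v} → Reach E u v → Reach E v u
  Reach-reverse E-sym here       = here
  Reach-reverse E-sym (step e p) = Reach-trans (Reach-reverse E-sym p) (step (E-sym _ _ e) here)

numArcs≡∑inDeg : ∀ {n} {D : Digraph n} (T : SubDigraph D) → numArcs T ≡ ∑[ v < n ] inDeg T v
numArcs≡∑inDeg {n} T = begin
  numArcs T                                   ≡⟨ sum-map-allFin (outDeg T) ⟩
  ∑[ u < n ] outDeg T u                       ≡⟨ sum-cong-≗ (λ u → count≡∑ (λ v → A T u v)) ⟩
  ∑[ u < n ] ∑[ v < n ] boolToℕ (A T u v)     ≡⟨ ∑-comm (λ u v → boolToℕ (A T u v)) ⟩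
  ∑[ v < n ] ∑[ u < n ] boolToℕ (A T u v)     ≡⟨ sum-cong-≗ (λ v → count≡∑ (λ u → A T u v)) ⟨
  ∑[ v < n ] inDeg T v                        ∎
  where
  open ≡-Reasoning

-- An out-tree on the vertex set W given by parent pointers; parent is arbitrary outside W ∖ {root}.
record ParentTree {n} (D : Digraph n) (W : Fin n → Bool) : Set where
  field
    root       : Fin n
    parent     : Fin n → Fin n
    root∈      : W root ≡ true
    parent∈    : ∀ {v} → W v ≡ true → v ≢ root → W (parent v) ≡ true
    parent-arc : ∀ {v} → W v ≡ true → v ≢ root → arc D (parent v) v ≡ true
    descends   : ∀ {v} → W v ≡ true → Descendant parent root v

module _ {n} {D : Digraph n} {W : Fin n → Bool} (P : ParentTree D W) where
  open ParentTree P

  treeArc : Fin n → Fin n → Bool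
  treeArc a b = (W ─ root) b ∧ does (a ≟ parent b)

  treeArc⇒ : ∀ {a b} → treeArc a b ≡ true → (W b ≡ true × b ≢ root) × a ≡ parent b
  treeArc⇒ {a} {b} e with b ≟ root | a ≟ parent b
  ... | yes _     | _        = contradiction e λ ()
  ... | no b≢root | yes a≡pb = (Bool.∧-conicalˡ _ _ e , b≢root) , a≡pb
  ... | no _      | no _     = contradiction (Bool.∧-conicalʳ (W b) false e) λ ()

  toSubDigraph : SubDigraph D
  toSubDigraph = record { V = W ; A = treeArc ; A⊆ = λ a b e → arcs⊆ (treeArc⇒ e) }
    where
    arcs⊆ : ∀ {a b} → (W b ≡ true × b ≢ root) × a ≡ parent b →
            (arc D a b ≡ true) × (W a ≡ true) × (W b ≡ true)
    arcs⊆ ((Wb , b≢root) , refl) = parent-arc Wb b≢root , parent∈ Wb b≢root , Wb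

  treeArc-parent : ∀ {v} → W v ≡ true → v ≢ root → treeArc (parent v) v ≡ true
  treeArc-parent {v} Wv v≢root = cong₂ _∧_ (─-intro {P = W} Wv v≢root) (dec-true (parent v ≟ parent v) refl)

  treeArc-antisym : ∀ a b → treeArc a b ≡ true → treeArc b a ≡ false
  treeArc-antisym a b ab = Bool.¬-not λ ba → two-cycle (treeArc⇒ ab) (treeArc⇒ ba)
    where
    two-cycle : (W b ≡ true × b ≢ root) × a ≡ parent b → (W a ≡ true × a ≢ root) × b ≡ parent a → ⊥
    two-cycle ((Wb , b≢root) , refl) ((Wa , a≢root) , b≡pa) = m≢1+n+m (generation δb) (begin
      generation δb                    ≡⟨ generation-parent b≢root δb δa ⟩
      suc (generation δa)              ≡⟨ cong suc (generation-parent a≢root δa δpa) ⟩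
      suc (suc (generation δpa))       ≡⟨ cong (λ g → suc (suc g)) (generation-unique (sym b≡pa) δpa δb) ⟩
      suc (suc (generation δb))        ∎)
      where
      open ≡-Reasoning
      δb  = descends Wb
      δa  = descends Wa
      δpa = descends (parent∈ Wa a≢root)

  inDeg-treeArc : ∀ b → inDeg toSubDigraph b ≡ boolToℕ ((W ─ root) b)
  inDeg-treeArc b with (W ─ root) b
  ... | true  = count-singleton (parent b)
  ... | false = all-false⇒count≡0 {n} (λ _ → refl)

  treeArcs+1≡vertices : numArcs toSubDigraph + 1 ≡ numVertices toSubDigraph
  treeArcs+1≡vertices = begin
    numArcs toSubDigraph + 1                     ≡⟨ cong (_+ 1) (numArcs≡∑inDeg toSubDigraph) ⟩
    ∑[ b < n ] inDeg toSubDigraph b + 1          ≡⟨ cong (_+ 1) (sum-cong-≗ inDeg-treeArc) ⟩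
    ∑[ b < n ] boolToℕ ((W ─ root) b) + 1        ≡⟨ cong (_+ 1) (count≡∑ (W ─ root)) ⟨
    count (W ─ root) + 1                         ≡⟨ +-comm _ 1 ⟩
    suc (count (W ─ root))                       ≡⟨ count-─ W root∈ ⟩
    count W                                      ∎
    where
    open ≡-Reasoning

  treeEdge-sym : ∀ u v → UNedge toSubDigraph u v ≡ true → UNedge toSubDigraph v u ≡ true
  treeEdge-sym u v e = trans (Bool.∨-comm (treeArc v u) (treeArc u v)) e

  reach-root : ∀ {v} → W v ≡ true → Descendant parent root v → Reach (UNedge toSubDigraph) v root
  reach-root Wv self               = here
  reach-root {v} Wv (child v≢root δ) =
    step (trans (cong (treeArc v (parent v) ∨_) (treeArc-parent Wv v≢root)) (Bool.∨-zeroʳ _))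
         (reach-root (parent∈ Wv v≢root) δ)

  toSubDigraph-isOutTree : IsOutTree toSubDigraph
  toSubDigraph-isOutTree =
    (treeArc-antisym , (root , root∈) , connected , treeArcs+1≡vertices) ,
    (root , root∈ , inDeg-root , only-root)
    where
    connected : ∀ u v → W u ≡ true → W v ≡ true → Reach (UNedge toSubDigraph) u v
    connected u v Wu Wv = Reach-trans (reach-root Wu (descends Wu))
                                      (Reach-reverse treeEdge-sym (reach-root Wv (descends Wv)))
    inDeg-root : inDeg toSubDigraph root ≡ 0
    inDeg-root rewrite inDeg-treeArc root | dec-true (root ≟ root) refl = refl
    only-root : ∀ v → W v ≡ true → inDeg toSubDigraph v ≡ 0 → v ≡ root
    only-root v Wv inDeg≡0 with v ≟ root | inDeg-treeArc v
    ... | yes v≡root | _   = v≡root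
    ... | no  _      | eq rewrite Wv = contradiction (trans (sym eq) inDeg≡0) λ ()

  count≤leaves : (S : Fin n → Bool) → (∀ v → S v ≡ true → W v ≡ true) →
                 (∀ v b → S v ≡ true → W b ≡ true → b ≢ root → parent b ≢ v) →
                 count S ≤ leaves toSubDigraph
  count≤leaves S S⊆W childless = count-mono λ v Sv →
    cong₂ _∧_ (S⊆W v Sv) (cong (_≡ᵇ 0) (all-false⇒count≡0 (no-child v Sv)))
    where
    no-child : ∀ v → S v ≡ true → ∀ b → treeArc v b ≡ false
    no-child v Sv b with b ≟ root | W b in Wb
    ... | yes _      | _     = refl
    ... | no  _      | false = refl
    ... | no  b≢root | true  = dec-false (v ≟ parent b) (λ v≡pb → childless v b Sv Wb b≢root (sym v≡pb))

outTree⇒parentTree : ∀ {n} {D : Digraph n} (T : SubDigraph D) → IsOutTree T → ParentTree D (V T)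
outTree⇒parentTree {n} {D} T
  ((_ , _ , connected , arcs+1≡vertices) , (root , root∈ , inDeg-root , only-root)) =
  record
    { root       = root
    ; parent     = parent
    ; root∈      = root∈
    ; parent∈    = λ Vv v≢root → proj₁ (proj₂ (A⊆ T _ _ (parent-in-arc Vv v≢root)))
    ; parent-arc = λ Vv v≢root → proj₁ (A⊆ T _ _ (parent-in-arc Vv v≢root))
    ; descends   = λ Vv → descends-along (connected root _ root∈ Vv) self
    }
  where
  inDeg≥nonRoot : ∀ v → boolToℕ ((V T ─ root) v) ≤ inDeg T v
  inDeg≥nonRoot v with v ≟ root | V T v in Vv
  ... | yes _      | _     = z≤n
  ... | no  _      | false = z≤n
  ... | no  v≢root | true  = n≢0⇒n>0 (λ inDeg≡0 → v≢root (only-root v Vv inDeg≡0))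

  ∑inDeg≡∑nonRoot : ∑[ v < n ] inDeg T v ≡ ∑[ v < n ] boolToℕ ((V T ─ root) v)
  ∑inDeg≡∑nonRoot = begin
    ∑[ v < n ] inDeg T v                  ≡⟨ numArcs≡∑inDeg T ⟨
    numArcs T                             ≡⟨ suc-injective suc-numArcs≡suc-count ⟩
    count (V T ─ root)                    ≡⟨ count≡∑ (V T ─ root) ⟩
    ∑[ v < n ] boolToℕ ((V T ─ root) v)   ∎
    where
    open ≡-Reasoning
    suc-numArcs≡suc-count : suc (numArcs T) ≡ suc (count (V T ─ root))
    suc-numArcs≡suc-count = trans (+-comm 1 (numArcs T)) (trans arcs+1≡vertices (sym (count-─ (V T) root∈)))

  -- In-degrees are at least 1 off the root and sum to |V| − 1, so they are exactly 1 there.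
  inDeg≡1 : ∀ {v} → V T v ≡ true → v ≢ root → inDeg T v ≡ 1
  inDeg≡1 {v} Vv v≢root = trans (sym (∑-tight inDeg≥nonRoot (≤-reflexive ∑inDeg≡∑nonRoot) v))
                                (cong boolToℕ (─-intro {P = V T} Vv v≢root))

  parent : Fin n → Fin n
  parent v = choose (λ u → A T u v) root

  in-neighbour : ∀ {v} → V T v ≡ true → v ≢ root → ∃[ u ] A T u v ≡ true
  in-neighbour {v} Vv v≢root = count≢0⇒∃ (λ u → A T u v)
    λ inDeg≡0 → contradiction (trans (sym (inDeg≡1 Vv v≢root)) inDeg≡0) λ ()

  parent-in-arc : ∀ {v} → V T v ≡ true → v ≢ root → A T (parent v) v ≡ true
  parent-in-arc {v} Vv v≢root = choose-correct (λ u → A T u v) root (proj₂ (in-neighbour Vv v≢root))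

  no-arc-to-root : ∀ {u v} → A T u v ≡ true → v ≢ root
  no-arc-to-root {u} Auv refl = contradiction (trans (sym Auv) (count≡0⇒false _ inDeg-root u)) λ ()

  parent-unique : ∀ {u v} → A T u v ≡ true → parent v ≡ u
  parent-unique {u} {v} Auv = count≡1⇒unique (λ u → A T u v) (inDeg≡1 Vv v≢root) Auv (parent-in-arc Vv v≢root)
    where
    Vv = proj₂ (proj₂ (A⊆ T u v Auv))
    v≢root = no-arc-to-root Auv

  descends-across : ∀ {u w} → UNedge T u w ≡ true → Descendant parent root u → Descendant parent root w
  descends-across {u} {w} _ δ with A T u w in Auw
  ... | true = child (no-arc-to-root Auw) (subst (Descendant parent root) (sym (parent-unique Auw)) δ)
  descends-across {u} {w} Awu self          | false = contradiction refl (no-arc-to-root Awu)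
  descends-across {u} {w} Awu (child _ δ) | false = subst (Descendant parent root) (parent-unique Awu) δ

  descends-along : ∀ {u v} → Reach (UNedge T) u v → Descendant parent root u → Descendant parent root v
  descends-along here       δ = δ
  descends-along (step e p) δ = descends-along p (descends-across e δ)

outBranching⇒parentTree : ∀ {n} {D : Digraph n} (T : SubDigraph D) → IsOutBranching T →
                          ParentTree D (λ _ → true)
outBranching⇒parentTree T (isOutTree , spanning) = record
  { root       = root
  ; parent     = parent
  ; root∈      = refl
  ; parent∈    = λ _ _ → refl
  ; parent-arc = λ _ → parent-arc (spanning _)
  ; descends   = λ _ → descends (spanning _)
  }
  where
  open ParentTree (outTree⇒parentTree T isOutTree)

-- Out-neighbours of subtrees

module _ {n} (D : Digraph n) where

  OutNeighbour : (Fin n → Bool) → Fin n → Set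
  OutNeighbour U v = U v ≡ false × ∃[ u ] (U u ≡ true × arc D u v ≡ true)

  outNeighbour? : (U : Fin n → Bool) (v : Fin n) → Dec (OutNeighbour U v)
  outNeighbour? U v = (U v Bool.≟ false) ×-dec any? (λ u → (U u Bool.≟ true) ×-dec (arc D u v Bool.≟ true))

  ∂⁺ : (Fin n → Bool) → Fin n → Bool
  ∂⁺ U v = does (outNeighbour? U v)

  ∂⁺-intro : ∀ U {u v} → U v ≡ false → U u ≡ true → arc D u v ≡ true → ∂⁺ U v ≡ true
  ∂⁺-intro U {u} {v} Uv Uu uv = dec-true (outNeighbour? U v) (Uv , u , Uu , uv)

  ∂⁺-elim : ∀ U {v} → ∂⁺ U v ≡ true → OutNeighbour U v
  ∂⁺-elim U {v} = does⇒ (outNeighbour? U v)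

module _ {n} {D : Digraph n} (P : ParentTree D (λ _ → true)) where
  open ParentTree P

  -- closed says that U is the vertex set of a subtree of P rooted at x.
  module Pendant (U : Fin n → Bool) {x : Fin n} (Ux : U x ≡ true)
                 (closed : ∀ {v} → U v ≡ true → v ≢ x → v ≢ root × U (parent v) ≡ true) where

    attach : Fin n → Fin n
    attach b = if U b then parent b else choose (λ u → U u ∧ arc D u b) x

    Extended : Fin n → Bool
    Extended v = U v ∨ ∂⁺ D U v

    attach-inner : ∀ {b} → U b ≡ true → attach b ≡ parent b
    attach-inner Ub rewrite Ub = refl

    attach-outer : ∀ {b} → ∂⁺ D U b ≡ true → U (attach b) ≡ true × arc D (attach b) b ≡ true
    attach-outer {b} ∂b with ∂⁺-elim D U ∂b
    ... | Ub , u , Uu , ub rewrite Ub = Bool.∧-conicalˡ _ _ chosen , Bool.∧-conicalʳ _ _ chosen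
      where chosen = choose-correct (λ u → U u ∧ arc D u b) x (cong₂ _∧_ Uu ub)

    attach-step : ∀ {b} → U b ∨ ∂⁺ D U b ≡ true → b ≢ x → U (attach b) ≡ true × arc D (attach b) b ≡ true
    attach-step Wb b≢x with ∨-split Wb
    ... | inj₁ Ub rewrite attach-inner Ub = proj₂ (closed Ub b≢x) , parent-arc refl (proj₁ (closed Ub b≢x))
    ... | inj₂ ∂b = attach-outer ∂b

    descends-inner : ∀ {v} → U v ≡ true → Descendant parent root v → Descendant attach x v
    descends-inner {v} Uv δ with v ≟ x | δ
    ... | yes refl | _          = self
    ... | no  v≢x  | self       = contradiction refl (proj₁ (closed Uv v≢x))
    ... | no  v≢x  | child _ δ′ = child v≢x (subst (Descendant attach x) (sym (attach-inner Uv))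
                                               (descends-inner (proj₂ (closed Uv v≢x)) δ′))

    descends-extended : ∀ {v} → U v ∨ ∂⁺ D U v ≡ true → Descendant attach x v
    descends-extended Wv with ∨-split Wv
    ... | inj₁ Uv = descends-inner Uv (descends refl)
    ... | inj₂ ∂v = child (λ { refl → contradiction (trans (sym Ux) (proj₁ (∂⁺-elim D U ∂v))) λ () })
                          (descends-inner (proj₁ (attach-outer ∂v)) (descends refl))

    extended : ParentTree D Extended
    extended = record
      { root       = x
      ; parent     = attach
      ; root∈      = cong (_∨ ∂⁺ D U x) Ux
      ; parent∈    = λ {b} Wb b≢x → cong (_∨ ∂⁺ D U (attach b)) (proj₁ (attach-step Wb b≢x))
      ; parent-arc = λ Wb b≢x → proj₂ (attach-step Wb b≢x)
      ; descends   = descends-extended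
      }

    ∂⁺≤leaves : count (∂⁺ D U) ≤ leaves (toSubDigraph extended)
    ∂⁺≤leaves = count≤leaves extended (∂⁺ D U)
      (λ v ∂v → trans (cong (U v ∨_) ∂v) (Bool.∨-zeroʳ (U v)))
      (λ v b ∂v Wb b≢x attach≡v → contradiction
         (trans (sym (proj₁ (∂⁺-elim D U ∂v)))
                (subst (λ w → U w ≡ true) attach≡v (proj₁ (attach-step Wb b≢x))))
         λ ())

  count-∂⁺-subtree≤ : ∀ {m} → (∀ T → IsOutTree {D = D} T → leaves T ≤ m) →
                      (U : Fin n → Bool) {x : Fin n} → U x ≡ true →
                      (∀ {v} → U v ≡ true → v ≢ x → v ≢ root × U (parent v) ≡ true) →
                      count (∂⁺ D U) ≤ m
  count-∂⁺-subtree≤ leaves≤m U Ux closed =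
    ≤-trans ∂⁺≤leaves (leaves≤m (toSubDigraph extended) (toSubDigraph-isOutTree extended))
    where
    open Pendant U Ux closed

-- The path decomposition by levels

module Levels {n} {D : Digraph n} (P : ParentTree D (λ _ → true)) where
  open ParentTree P

  depth : Fin n → ℕ
  depth v = generation (descends {v} refl)

  depth-root : depth root ≡ 0
  depth-root = generation-unique refl (descends refl) self

  depth-parent : ∀ {v} → v ≢ root → depth v ≡ suc (depth (parent v))
  depth-parent v≢root = generation-parent v≢root (descends refl) (descends refl)

  0<depth⇒≢root : ∀ {v} → 0 < depth v → v ≢ root
  0<depth⇒≢root 0<d refl = contradiction depth-root (>⇒≢ 0<d)

  depth-iterate : ∀ j {v} → j ≤ depth v → depth (iterate parent v j) ≡ depth v ∸ j
  depth-iterate zero    _   = refl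
  depth-iterate (suc j) {v} j<d = begin
    depth (iterate parent (parent v) j)   ≡⟨ depth-iterate j (s≤s⁻¹ (subst (suc j ≤_) d≡ j<d)) ⟩
    depth (parent v) ∸ j                  ≡⟨ cong (_∸ suc j) d≡ ⟨
    depth v ∸ suc j                       ∎
    where
    open ≡-Reasoning
    d≡ = depth-parent (0<depth⇒≢root (≤-trans (s≤s z≤n) j<d))

  ancestorAt : ℕ → Fin n → Fin n
  ancestorAt s v = iterate parent v (depth v ∸ s)

  depth-ancestorAt : ∀ {s v} → s ≤ depth v → depth (ancestorAt s v) ≡ s
  depth-ancestorAt {s} {v} s≤d = trans (depth-iterate (depth v ∸ s) (m∸n≤m (depth v) s)) (m∸[m∸n]≡n s≤d)

  ancestorAt-depth : ∀ {s v} → depth v ≡ s → ancestorAt s v ≡ v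
  ancestorAt-depth {v = v} refl = cong (iterate parent v) (n∸n≡0 (depth v))

  ancestorAt-parent : ∀ {s v} → s < depth v → ancestorAt s (parent v) ≡ ancestorAt s v
  ancestorAt-parent {s} {v} s<d = cong (iterate parent v) (sym (begin
    depth v ∸ s                 ≡⟨ cong (_∸ s) d≡ ⟩
    suc (depth (parent v)) ∸ s  ≡⟨ +-∸-assoc 1 (s≤s⁻¹ (subst (s <_) d≡ s<d)) ⟩
    suc (depth (parent v) ∸ s)  ∎))
    where
    open ≡-Reasoning
    d≡ = depth-parent (0<depth⇒≢root (≤-<-trans z≤n s<d))

  Ball : ℕ → Fin n → Bool
  Ball t v = does (depth v ≤? t)

  Beyond : ℕ → Fin n → Bool
  Beyond t v = does (t <? depth v)

  Level : ℕ → Fin n → Bool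
  Level t v = does (depth v ℕ.≟ t)

  InBag : ℕ → Fin n → Set
  InBag t v = depth v ≡ t ⊎ OutNeighbour D (Ball t) v ⊎ OutNeighbour D (Beyond t) v

  inBag? : ∀ t v → Dec (InBag t v)
  inBag? t v = (depth v ℕ.≟ t) ⊎-dec outNeighbour? D (Ball t) v ⊎-dec outNeighbour? D (Beyond t) v

  Bag : ℕ → Fin n → Bool
  Bag t v = does (inBag? t v)

  Front : ℕ → Fin n → Bool
  Front t = ∂⁺ D (Ball t)

  Back : ℕ → Fin n → Bool
  Back t = ∂⁺ D (Beyond t)

  InBranch : ℕ → Fin n → Fin n → Set
  InBranch t x v = t < depth v × ancestorAt (suc t) v ≡ x

  inBranch? : ∀ t x v → Dec (InBranch t x v)
  inBranch? t x v = (t <? depth v) ×-dec (ancestorAt (suc t) v ≟ x)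

  Branch : ℕ → Fin n → Fin n → Bool
  Branch t x v = does (inBranch? t x v)

  front : ∀ {t u v} → t < depth v → depth u ≤ t → arc D u v ≡ true → InBag t v
  front {t} {u} {v} t<dv du≤t uv =
    inj₂ (inj₁ (dec-false (depth v ≤? t) (<⇒≱ t<dv) , u , dec-true (depth u ≤? t) du≤t , uv))

  back : ∀ {t u v} → depth v ≤ t → t < depth u → arc D u v ≡ true → InBag t v
  back {t} {u} {v} dv≤t t<du uv =
    inj₂ (inj₂ (dec-false (t <? depth v) (≤⇒≯ dv≤t) , u , dec-true (t <? depth u) t<du , uv))

  inBag-below : ∀ {t v} → t < depth v → InBag t v → ∃[ u ] (depth u ≤ t × arc D u v ≡ true)
  inBag-below t<dv (inj₁ refl)                       = contradiction t<dv (<-irrefl refl)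
  inBag-below {t} t<dv (inj₂ (inj₁ (_ , u , Bu , uv))) = u , does⇒ (depth u ≤? t) Bu , uv
  inBag-below {t} {v} t<dv (inj₂ (inj₂ (Bv , _)))   = contradiction t<dv (does⇒¬ (t <? depth v) Bv)

  inBag-above : ∀ {t v} → depth v < t → InBag t v → ∃[ u ] (t < depth u × arc D u v ≡ true)
  inBag-above dv<t (inj₁ refl)                       = contradiction dv<t (<-irrefl refl)
  inBag-above {t} {v} dv<t (inj₂ (inj₁ (Bv , _)))   = contradiction (<⇒≤ dv<t) (does⇒¬ (depth v ≤? t) Bv)
  inBag-above {t} dv<t (inj₂ (inj₂ (_ , u , Bu , uv))) = u , does⇒ (t <? depth u) Bu , uv

  inBag-interval : ∀ {a b c v} → a ≤ b → b ≤ c → InBag a v → InBag c v → InBag b v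
  inBag-interval {a} {b} {c} {v} a≤b b≤c in-a in-c with <-cmp b (depth v)
  ... | tri≈ _ b≡dv _ = inj₁ (sym b≡dv)
  ... | tri< b<dv _ _ with inBag-below (≤-<-trans a≤b b<dv) in-a
  ...   | u , du≤a , uv = front b<dv (≤-trans du≤a a≤b) uv
  inBag-interval {a} {b} {c} {v} a≤b b≤c in-a in-c | tri> _ _ dv<b
    with inBag-above (<-≤-trans dv<b b≤c) in-c
  ...   | u , c<du , uv = back (<⇒≤ dv<b) (≤-<-trans b≤c c<du) uv

  arc⇒inBag : ∀ {a b} → arc D a b ≡ true → ∃[ t ] (t ≤ depth a × InBag t a × InBag t b)
  arc⇒inBag {a} {b} ab with <-cmp (depth a) (depth b)
  ... | tri< da<db _ _ = depth a , ≤-refl , inj₁ refl , front da<db ≤-refl ab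
  ... | tri≈ _ da≡db _ = depth a , ≤-refl , inj₁ refl , inj₁ (sym da≡db)
  ... | tri> _ _ db<da =
    depth (parent a) , <⇒≤ pa<a , front pa<a ≤-refl (parent-arc refl a≢root) ,
    back (s≤s⁻¹ (subst (depth b <_) da≡ db<da)) pa<a ab
    where
    a≢root = 0<depth⇒≢root (≤-<-trans z≤n db<da)
    da≡ = depth-parent a≢root
    pa<a : depth (parent a) < depth a
    pa<a = subst (depth (parent a) <_) (sym da≡) ≤-refl

  -- Any common bound on the depths will do; the sum avoids defining a maximum.
  maxDepth : ℕ
  maxDepth = ∑[ v < n ] depth v

  inBag⇒Bag : ∀ {t v} (t≤max : t ≤ maxDepth) → InBag t v → Bag (toℕ (fromℕ< (s≤s t≤max))) v ≡ true
  inBag⇒Bag {t} {v} t≤max in-t =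
    dec-true (inBag? _ v) (subst (λ s → InBag s v) (sym (toℕ-fromℕ< (s≤s t≤max))) in-t)

  levelDecomposition : PathDecomposition (UN D)
  levelDecomposition = record
    { r        = suc maxDepth
    ; X        = λ i → Bag (toℕ i)
    ; covers   = λ v → _ , inBag⇒Bag (term≤∑ depth v) (inj₁ refl)
    ; edges    = edge-in-bag
    ; interval = λ v i j l i≤j j≤l in-i in-l →
        dec-true (inBag? _ v) (inBag-interval i≤j j≤l (does⇒ (inBag? _ v) in-i) (does⇒ (inBag? _ v) in-l))
    }
    where
    shared : ∀ {a b} → arc D a b ≡ true →
             ∃[ i ] (Bag (toℕ {suc maxDepth} i) a ≡ true × Bag (toℕ i) b ≡ true)
    shared {a} ab with arc⇒inBag ab
    ... | t , t≤da , in-a , in-b = _ , inBag⇒Bag t≤max in-a , inBag⇒Bag t≤max in-b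
      where t≤max = ≤-trans t≤da (term≤∑ depth a)
    edge-in-bag : ∀ u v → UN D u v ≡ true →
                  ∃[ i ] (Bag (toℕ {suc maxDepth} i) u ≡ true × Bag (toℕ i) v ≡ true)
    edge-in-bag u v uv with ∨-split uv
    ... | inj₁ arc-uv = shared arc-uv
    ... | inj₂ arc-vu with shared arc-vu
    ...   | i , in-v , in-u = i , in-u , in-v

  module _ {m} (leaves≤m : ∀ T → IsOutTree {D = D} T → leaves T ≤ m) where

    count-front≤ : ∀ t → count (Front t) ≤ m
    count-front≤ t = count-∂⁺-subtree≤ P leaves≤m (Ball t) root∈Ball closed
      where
      root∈Ball : Ball t root ≡ true
      root∈Ball = dec-true (depth root ≤? t) (subst (_≤ t) (sym depth-root) z≤n)
      closed : ∀ {v} → Ball t v ≡ true → v ≢ root → v ≢ root × Ball t (parent v) ≡ true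
      closed {v} Bv v≢root = v≢root , dec-true (depth (parent v) ≤? t)
        (≤-trans (n≤1+n _) (subst (_≤ t) (depth-parent v≢root) (does⇒ (depth v ≤? t) Bv)))

    count-level≤ : 0 < m → ∀ t → count (Level t) ≤ m
    count-level≤ 0<m zero = begin
      count (Level 0)                   ≤⟨ count-mono level0⊆root ⟩
      count (λ v → does (v ≟ root))     ≡⟨ count-singleton root ⟩
      1                                 ≤⟨ 0<m ⟩
      m                                 ∎
      where
      open ≤-Reasoning
      level0⊆root : ∀ v → Level 0 v ≡ true → does (v ≟ root) ≡ true
      level0⊆root v L0v with v ≟ root
      ... | yes _      = refl
      ... | no  v≢root = contradiction (trans (sym (depth-parent v≢root)) (does⇒ (depth v ℕ.≟ 0) L0v)) λ ()
    count-level≤ 0<m (suc t) = ≤-trans (count-mono level⊆front) (count-front≤ t)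
      where
      level⊆front : ∀ v → Level (suc t) v ≡ true → Front t v ≡ true
      level⊆front v Lv = ∂⁺-intro D (Ball t)
        (dec-false (depth v ≤? t) (λ dv≤t → 1+n≰n (subst (_≤ t) dv≡ dv≤t)))
        (dec-true (depth (parent v) ≤? t)
                  (≤-reflexive (suc-injective (trans (sym (depth-parent v≢root)) dv≡))))
        (parent-arc refl v≢root)
        where
        dv≡ = does⇒ (depth v ℕ.≟ suc t) Lv
        v≢root = 0<depth⇒≢root (subst (0 <_) (sym dv≡) (s≤s z≤n))

    count-branch-boundary≤ : ∀ t {x} → Level (suc t) x ≡ true → count (∂⁺ D (Branch t x)) ≤ m
    count-branch-boundary≤ t {x} Lx = count-∂⁺-subtree≤ P leaves≤m (Branch t x) x∈Branch closed
      where
      dx≡ = does⇒ (depth x ℕ.≟ suc t) Lx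
      x∈Branch : Branch t x x ≡ true
      x∈Branch = dec-true (inBranch? t x x) (subst (t <_) (sym dx≡) ≤-refl , ancestorAt-depth dx≡)
      closed : ∀ {v} → Branch t x v ≡ true → v ≢ x → v ≢ root × Branch t x (parent v) ≡ true
      closed {v} Bv v≢x with does⇒ (inBranch? t x v) Bv
      ... | t<dv , anc≡x with depth v ℕ.≟ suc t
      ...   | yes dv≡ = contradiction (trans (sym (ancestorAt-depth dv≡)) anc≡x) v≢x
      ...   | no  dv≢ = v≢root , dec-true (inBranch? t x (parent v))
                          (s≤s⁻¹ (subst (suc t <_) (depth-parent v≢root) st<dv) ,
                           trans (ancestorAt-parent st<dv) anc≡x)
        where
        st<dv = ≤∧≢⇒< t<dv (dv≢ ∘ sym)
        v≢root = 0<depth⇒≢root (≤-<-trans z≤n t<dv)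

    count-back≤ : 0 < m → ∀ t → count (Back t) ≤ m * m
    count-back≤ 0<m t = ≤-trans
      (count-cover (Level (suc t)) (λ x → ∂⁺ D (Branch t x)) (Back t) covered
                   (λ x Lx → count-branch-boundary≤ t Lx))
      (*-monoˡ-≤ m (count-level≤ 0<m (suc t)))
      where
      covered : ∀ v → Back t v ≡ true →
                ∃[ x ] (Level (suc t) x ≡ true × ∂⁺ D (Branch t x) v ≡ true)
      covered v ∂v with ∂⁺-elim D (Beyond t) ∂v
      ... | Bv , u , Bu , uv = x , dec-true (depth x ℕ.≟ suc t) (depth-ancestorAt t<du) ,
        ∂⁺-intro D (Branch t x)
          (dec-false (inBranch? t x v) (does⇒¬ (t <? depth v) Bv ∘ proj₁))
          (dec-true (inBranch? t x u) (t<du , refl))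
          uv
        where
        t<du = does⇒ (t <? depth u) Bu
        x = ancestorAt (suc t) u

    count-bag≤ : 0 < m → ∀ t → count (Bag t) ≤ m * (m + 2)
    count-bag≤ 0<m t = begin
      count (Bag t)
        ≤⟨ count-∨ (Level t) (λ v → Front t v ∨ Back t v) ⟩
      count (Level t) + count (λ v → Front t v ∨ Back t v)
        ≤⟨ +-monoʳ-≤ (count (Level t)) (count-∨ (Front t) (Back t)) ⟩
      count (Level t) + (count (Front t) + count (Back t))
        ≤⟨ +-mono-≤ (count-level≤ 0<m t) (+-mono-≤ (count-front≤ t) (count-back≤ 0<m t)) ⟩
      m + (m + m * m)
        ≡⟨ expand m ⟩
      m * (m + 2)
        ∎
      where
      open ≤-Reasoning
      expand : ∀ m → m + (m + m * m) ≡ m * (m + 2)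
      expand = solve-∀

pathwidth≤m[m+2] : ∀ {n} (D : Digraph n) {m} → HasOutBranching D →
                   (∀ T → IsOutTree {D = D} T → leaves T ≤ m) → 0 < m →
                   PathwidthAtMost (UN D) (m * (m + 2))
pathwidth≤m[m+2] D (T , isOutBranching) leaves≤m 0<m =
  levelDecomposition , λ i → ≤-trans (count-bag≤ leaves≤m 0<m (toℕ i)) (n≤1+n _)
  where
  open Levels (outBranching⇒parentTree T isOutBranching)

pathwidth-mono : ∀ {n} {E : Fin n → Fin n → Bool} {w w′} → w ≤ w′ →
                 PathwidthAtMost E w → PathwidthAtMost E w′
pathwidth-mono w≤w′ (P , width≤w) = P , λ i → ≤-trans (width≤w i) (s≤s w≤w′)

m<k⇒m[m+2]≤k³ : ∀ {m k} → m < k → m * (m + 2) ≤ k ^ 3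
m<k⇒m[m+2]≤k³ {m} {k} m<k = begin
  m * (m + 2)                                       ≤⟨ m≤m+n _ _ ⟩
  m * (m + 2) + (m * m * m + 2 * (m * m) + m + 1)   ≡⟨ expand m ⟨
  suc m ^ 3                                         ≤⟨ ^-monoˡ-≤ 3 m<k ⟩
  k ^ 3                                             ∎
  where
  open ≤-Reasoning
  expand : ∀ m → suc m * (suc m * (suc m * 1)) ≡ m * (m + 2) + (m * m * m + 2 * (m * m) + m + 1)
  expand = solve-∀

theorem4p1 : (k : ℕ) → 1 ≤ k → (n : ℕ) (D : Digraph n) → InL D →
    (m : ℕ) → IsEllS D m → 0 < m → k ≤ m ⊎ PathwidthAtMost (UN D) (k ^ 3)
theorem4p1 k _ n D inL m ellS 0<m with k ≤? m | ellS | inL m ellS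
... | yes k≤m | _                              | _                   = inj₁ k≤m
... | no  _   | inj₁ (_ , m≡0)                 | _                   = contradiction m≡0 (>⇒≢ 0<m)
... | no  _   | inj₂ _                         | inj₁ m≡0            = contradiction m≡0 (>⇒≢ 0<m)
... | no  k≰m | inj₂ ((T , branching , _) , _) | inj₂ (_ , leaves≤m) =
  inj₂ (pathwidth-mono (m<k⇒m[m+2]≤k³ (≰⇒> k≰m)) (pathwidth≤m[m+2] D (T , branching) leaves≤m 0<m))
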